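{- Let $X$ and $Y$ be types equipped with operators $\mathrm{int}_X:\mathcal P(X)\to\mathcal P(X)$ and $\mathrm{int}_Y:\mathcal P(Y)\to\mathcal P(Y)$, and define $\mathrm{int}^{\&}:\mathcal P(X\times Y)\to\mathcal P(X\times Y)$ by $\mathrm{int}^{\&}s:=\{z:X\times Y\mid\exists u:\mathcal P(X),v:\mathcal P(Y),\ z\in\mathrm{int}_X u\times^{\otimes}\mathrm{int}_Y v\otimes u\times^{\&}v\subseteq s\}$. Then: if both $\mathrm{int}_X,\mathrm{int}_Y$ satisfy (I1), so does $\mathrm{int}^{\&}$; $\mathrm{int}^{\&}$ always satisfies (I2); if both satisfy (I4), so does $\mathrm{int}^{\&}$; if both satisfy (I5), so does $\mathrm{int}^{\&}$. Consequently, if $\mathrm{int}_X$ and $\mathrm{int}_Y$ are Čech interior operators, then so is $\mathrm{int}^{\&}$.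
   Context: Framework: constructive mathematics with affine logic as internal logic (classical linear logic with weakening but without contraction). Connectives: $\otimes$ (multiplicative conjunction, unit $\top$), $\mathbin{\mathrm{par}}$ (multiplicative disjunction), $\mathbin{\&}$ (additive conjunction), $\oplus$ (additive disjunction), involutive negation $\neg$, $\multimap$, exponentials $!,?$; $\forall,\exists$ usual (additive) quantifiers; $\otimes,\mathbin{\&}$ bind tighter than $\mathbin{\mathrm{par}},\oplus,\multimap$. $\Omega$ is the impredicative type of propositions, $\mathcal P(X):=X\to\Omega$, $x\in s$ means $s(x)$, $s\subseteq t:=\forall x,(x\in s\multimap x\in t)$, $s\boxtimes t:=\{x\mid x\in s\otimes x\in t\}$, $s\sqcap t:=\{x\mid x\in s\mathbin{\&}x\in t\}$, and $X$ also denotes $\{x\mid\top\}$. For $u:\mathcal P(X)$, $v:\mathcal P(Y)$: $u\times^{\otimes}v:=\{(x,y)\mid x\in u\otimes y\in v\}$ and $u\times^{\&}v:=\{(x,y)\mid x\in u\mathbin{\&}y\in v\}$. Conditions on an operator $\mathrm{int}$ on a type $Z$, for all $s,t:\mathcal P(Z)$: (I1) $\mathrm{int}\,s\subseteq s$; (I2) $s\subseteq t\multimap\mathrm{int}\,s\subseteq\mathrm{int}\,t$; (I3) $\mathrm{int}\,s\subseteq\mathrm{int}(\mathrm{int}\,s)$; (I4) $Z\subseteq\mathrm{int}\,Z$; (I5) $\mathrm{int}\,s\boxtimes\mathrm{int}\,t\subseteq\mathrm{int}(s\sqcap t)$. A Čech interior operator satisfies (I1), (I2), (I4), (I5). -}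

module Defs where

open import Data.Product using (_×_; _,_)

-- An abstract model of the internal logic: impredicative classical affine
-- logic (classical linear logic with weakening, without contraction),
-- presented algebraically as an entailment preorder on a type Ω of
-- propositions.  Ω : Set, and the quantifiers range over arbitrary
-- A : Set (in particular over 𝒫 X = X → Ω), which gives impredicativity.
record AffineLogic : Set₁ where
  infix  3 _⊢_
  infixr 7 _⊗_
  infixr 7 _&_
  infixr 6 _⊕_
  infix  10 ¬_
  field
    Ω   : Set
    _⊢_ : Ω → Ω → Set
    ⊢-refl  : ∀ {A} → A ⊢ A
    ⊢-trans : ∀ {A B C} → A ⊢ B → B ⊢ C → A ⊢ C
    ⊤   : Ω
    _⊗_ : Ω → Ω → Ω
    ⊗-mono   : ∀ {A A′ B B′} → A ⊢ A′ → B ⊢ B′ → A ⊗ B ⊢ A′ ⊗ B′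
    ⊗-assoc  : ∀ {A B C} → (A ⊗ B) ⊗ C ⊢ A ⊗ (B ⊗ C)
    ⊗-assoc⁻ : ∀ {A B C} → A ⊗ (B ⊗ C) ⊢ (A ⊗ B) ⊗ C
    ⊗-comm   : ∀ {A B} → A ⊗ B ⊢ B ⊗ A
    ⊗-unit   : ∀ {A} → A ⊗ ⊤ ⊢ A
    ⊗-unit⁻  : ∀ {A} → A ⊢ A ⊗ ⊤
    weaken   : ∀ {A} → A ⊢ ⊤
    -- involutive negation (classical), *-autonomous closure:
    -- A ⊸ B is ¬ (A ⊗ ¬ B)
    ¬_       : Ω → Ω
    ¬-anti   : ∀ {A B} → A ⊢ B → ¬ B ⊢ ¬ A
    ¬¬-elim  : ∀ {A} → ¬ ¬ A ⊢ A
    ¬¬-intro : ∀ {A} → A ⊢ ¬ ¬ A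
    curry    : ∀ {A B C} → A ⊗ B ⊢ C → A ⊢ ¬ (B ⊗ ¬ C)
    uncurry  : ∀ {A B C} → A ⊢ ¬ (B ⊗ ¬ C) → A ⊗ B ⊢ C
    _&_      : Ω → Ω → Ω
    &-intro  : ∀ {C A B} → C ⊢ A → C ⊢ B → C ⊢ A & B
    &-fst    : ∀ {A B} → A & B ⊢ A
    &-snd    : ∀ {A B} → A & B ⊢ B
    _⊕_      : Ω → Ω → Ω
    ⊕-inl    : ∀ {A B} → A ⊢ A ⊕ B
    ⊕-inr    : ∀ {A B} → B ⊢ A ⊕ B
    ⊕-elim   : ∀ {A B C} → A ⊢ C → B ⊢ C → A ⊕ B ⊢ C
    ∀'       : {A : Set} → (A → Ω) → Ω
    ∀-intro  : ∀ {A : Set} {C} {φ : A → Ω} → ((a : A) → C ⊢ φ a) → C ⊢ ∀' φ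
    ∀-elim   : ∀ {A : Set} {φ : A → Ω} (a : A) → ∀' φ ⊢ φ a
    ∃'       : {A : Set} → (A → Ω) → Ω
    ∃-intro  : ∀ {A : Set} {φ : A → Ω} (a : A) → φ a ⊢ ∃' φ
    ∃-elim   : ∀ {A : Set} {C} {φ : A → Ω} → ((a : A) → φ a ⊢ C) → ∃' φ ⊢ C

module Internal (L : AffineLogic) where
  open AffineLogic L public

  infixr 5 _⊸_
  infixr 6 _par_
  infix  8 _∈_ _⊆_
  infixr 9 _⊠_ _⊓_ _×⊗_ _×&_

  _⊸_ : Ω → Ω → Ω
  A ⊸ B = ¬ (A ⊗ ¬ B)

  _par_ : Ω → Ω → Ω
  A par B = ¬ (¬ A ⊗ ¬ B)

  𝒫 : Set → Set
  𝒫 X = X → Ω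

  _∈_ : {X : Set} → X → 𝒫 X → Ω
  x ∈ s = s x

  _⊆_ : {X : Set} → 𝒫 X → 𝒫 X → Ω
  s ⊆ t = ∀' λ x → x ∈ s ⊸ x ∈ t

  _⊠_ : {X : Set} → 𝒫 X → 𝒫 X → 𝒫 X
  (s ⊠ t) x = x ∈ s ⊗ x ∈ t

  _⊓_ : {X : Set} → 𝒫 X → 𝒫 X → 𝒫 X
  (s ⊓ t) x = x ∈ s & x ∈ t

  full : (X : Set) → 𝒫 X
  full X x = ⊤

  _×⊗_ : {X Y : Set} → 𝒫 X → 𝒫 Y → 𝒫 (X × Y)
  (u ×⊗ v) (x , y) = x ∈ u ⊗ y ∈ v

  _×&_ : {X Y : Set} → 𝒫 X → 𝒫 Y → 𝒫 (X × Y)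
  (u ×& v) (x , y) = x ∈ u & y ∈ v

  I1 : {Z : Set} → (𝒫 Z → 𝒫 Z) → Ω
  I1 int = ∀' λ s → int s ⊆ s

  I2 : {Z : Set} → (𝒫 Z → 𝒫 Z) → Ω
  I2 int = ∀' λ s → ∀' λ t → (s ⊆ t) ⊸ (int s ⊆ int t)

  I3 : {Z : Set} → (𝒫 Z → 𝒫 Z) → Ω
  I3 int = ∀' λ s → int s ⊆ int (int s)

  I4 : {Z : Set} → (𝒫 Z → 𝒫 Z) → Ω
  I4 {Z} int = full Z ⊆ int (full Z)

  I5 : {Z : Set} → (𝒫 Z → 𝒫 Z) → Ω
  I5 int = ∀' λ s → ∀' λ t → (int s ⊠ int t) ⊆ int (s ⊓ t)

  Cech : {Z : Set} → (𝒫 Z → 𝒫 Z) → Ω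
  Cech int = I1 int & I2 int & I4 int & I5 int

  int& : {X Y : Set} → (𝒫 X → 𝒫 X) → (𝒫 Y → 𝒫 Y) → 𝒫 (X × Y) → 𝒫 (X × Y)
  int& intX intY s z =
    ∃' λ (u : 𝒫 _) → ∃' λ (v : 𝒫 _) →
      z ∈ (intX u ×⊗ intY v) ⊗ (u ×& v) ⊆ s

{-# OPTIONS --safe #-}
-- Each axiom transfers coordinatewise through such witnesses.
-- (I1) uses weakening to pass from u ×⊗ v to u ×& v; (I5) combines the
-- witnesses (u , v) of s and (u′ , v′) of t into (u ⊓ u′ , v ⊓ v′),
-- interchanging the two tensor factors so that I5 applies in each coordinate.
module Submission where

open import Defs
open import Data.Product using (_×_; _,_)

module AffineReasoning (L : AffineLogic) where
  open Internal L

  infixr 4 _⨾_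
  _⨾_ : ∀ {A B C} → A ⊢ B → B ⊢ C → A ⊢ C
  _⨾_ = ⊢-trans

  ⊸-eval : ∀ {A B} → (A ⊸ B) ⊗ A ⊢ B
  ⊸-eval = uncurry ⊢-refl

  ⊗-projˡ : ∀ {A B} → A ⊗ B ⊢ A
  ⊗-projˡ = ⊗-mono ⊢-refl weaken ⨾ ⊗-unit

  ⊗-projʳ : ∀ {A B} → A ⊗ B ⊢ B
  ⊗-projʳ = ⊗-comm ⨾ ⊗-projˡ

  ⊗⇒& : ∀ {A B} → A ⊗ B ⊢ A & B
  ⊗⇒& = &-intro ⊗-projˡ ⊗-projʳ

  ⊗-interchange : ∀ {A B C D} → (A ⊗ B) ⊗ (C ⊗ D) ⊢ (A ⊗ C) ⊗ (B ⊗ D)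
  ⊗-interchange =
    ⊗-assoc ⨾ ⊗-mono ⊢-refl (⊗-assoc⁻ ⨾ ⊗-mono ⊗-comm ⊢-refl ⨾ ⊗-assoc) ⨾ ⊗-assoc⁻

  ∃-elimʳ : ∀ {A : Set} {C D} {φ : A → Ω} → ((a : A) → C ⊗ φ a ⊢ D) → C ⊗ ∃' φ ⊢ D
  ∃-elimʳ h = ⊗-comm ⨾ uncurry (∃-elim λ a → curry (⊗-comm ⨾ h a))

  ⊆-elim : ∀ {Z : Set} {s t : 𝒫 Z} (z : Z) → (s ⊆ t) ⊗ z ∈ s ⊢ z ∈ t
  ⊆-elim z = ⊗-mono (∀-elim z) ⊢-refl ⨾ ⊸-eval

  ⊆-intro : ∀ {Z : Set} {C} {s t : 𝒫 Z} → ((z : Z) → C ⊗ z ∈ s ⊢ z ∈ t) → C ⊢ s ⊆ t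
  ⊆-intro h = ∀-intro λ z → curry (h z)

  ⊆-trans : ∀ {Z : Set} {s t u : 𝒫 Z} → (s ⊆ t) ⊗ (t ⊆ u) ⊢ s ⊆ u
  ⊆-trans {s = s} {t} {u} = ⊆-intro λ z →
    ⊗-mono ⊗-comm ⊢-refl ⨾ ⊗-assoc ⨾ ⊗-mono ⊢-refl (⊆-elim {s = s} {t} z) ⨾ ⊆-elim {s = t} {u} z

  ⊆-full : ∀ {Z : Set} {C} {s : 𝒫 Z} → C ⊢ s ⊆ full Z
  ⊆-full = ⊆-intro λ _ → weaken

  ×⊗-mono : ∀ {X Y : Set} {u u′ : 𝒫 X} {v v′ : 𝒫 Y} →
            (u ⊆ u′) ⊗ (v ⊆ v′) ⊢ u ×⊗ v ⊆ u′ ×⊗ v′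
  ×⊗-mono = ⊆-intro λ { (x , y) → ⊗-interchange ⨾ ⊗-mono (⊆-elim x) (⊆-elim y) }

  ×&-⊓-⊆ : ∀ {X Y : Set} {u u′ : 𝒫 X} {v v′ : 𝒫 Y} {s t : 𝒫 (X × Y)} →
           (u ×& v ⊆ s) ⊗ (u′ ×& v′ ⊆ t) ⊢ (u ⊓ u′) ×& (v ⊓ v′) ⊆ s ⊓ t
  ×&-⊓-⊆ = ⊆-intro λ { (x , y) → &-intro
    (⊗-mono ⊗-projˡ (&-intro (&-fst ⨾ &-fst) (&-snd ⨾ &-fst)) ⨾ ⊆-elim (x , y))
    (⊗-mono ⊗-projʳ (&-intro (&-fst ⨾ &-snd) (&-snd ⨾ &-snd)) ⨾ ⊆-elim (x , y)) }

module ProductInterior (L : AffineLogic) {X Y : Set}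
    (intX : (X → AffineLogic.Ω L) → (X → AffineLogic.Ω L))
    (intY : (Y → AffineLogic.Ω L) → (Y → AffineLogic.Ω L)) where
  open Internal L
  open AffineReasoning L

  int&-intro : ∀ {s z} (u : 𝒫 X) (v : 𝒫 Y) →
               z ∈ intX u ×⊗ intY v ⊗ (u ×& v ⊆ s) ⊢ z ∈ int& intX intY s
  int&-intro u v = ∃-intro v ⨾ ∃-intro u

  int&-elim : ∀ {s z C D} →
              ((u : 𝒫 X) (v : 𝒫 Y) → C ⊗ (z ∈ intX u ×⊗ intY v ⊗ (u ×& v ⊆ s)) ⊢ D) →
              C ⊗ z ∈ int& intX intY s ⊢ D
  int&-elim h = ∃-elimʳ λ u → ∃-elimʳ λ v → h u v

  ×⊗-I1 : ∀ {u v} → I1 intX ⊗ I1 intY ⊢ intX u ×⊗ intY v ⊆ u ×& v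
  ×⊗-I1 {u} {v} = ⊆-intro λ { (x , y) →
    ⊗-mono (⊗-mono (∀-elim u) (∀-elim v) ⨾ ×⊗-mono) ⊢-refl ⨾ ⊆-elim (x , y) ⨾ ⊗⇒& }

  int&-I1 : I1 intX ⊗ I1 intY ⊢ I1 (int& intX intY)
  int&-I1 = ∀-intro λ s → ⊆-intro λ z → int&-elim λ u v →
    ⊗-assoc⁻ ⨾ ⊗-mono (⊗-mono ×⊗-I1 ⊢-refl ⨾ ⊆-elim z) ⊢-refl ⨾ ⊗-comm ⨾ ⊆-elim z

  int&-mono : ∀ {s t} → s ⊆ t ⊢ int& intX intY s ⊆ int& intX intY t
  int&-mono = ⊆-intro λ z → int&-elim λ u v →
    ⊗-comm ⨾ ⊗-assoc ⨾ ⊗-mono ⊢-refl ⊆-trans ⨾ int&-intro u v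

  int&-I2 : ⊤ ⊢ I2 (int& intX intY)
  int&-I2 = ∀-intro λ s → ∀-intro λ t → curry (⊗-projʳ ⨾ int&-mono)

  int&-I4 : I4 intX ⊗ I4 intY ⊢ I4 (int& intX intY)
  int&-I4 = ⊆-intro λ { (x , y) →
    ⊗-unit ⨾ ⊗-mono (⊗-unit⁻ ⨾ ⊆-elim x) (⊗-unit⁻ ⨾ ⊆-elim y)
    ⨾ ⊗-unit⁻ ⨾ ⊗-mono ⊢-refl ⊆-full ⨾ int&-intro (full X) (full Y) }

  int&-⊠-elim : ∀ {s t z C D} →
                ((u u′ : 𝒫 X) (v v′ : 𝒫 Y) →
                 C ⊗ ((z ∈ intX u ×⊗ intY v ⊗ (u ×& v ⊆ s)) ⊗
                      (z ∈ intX u′ ×⊗ intY v′ ⊗ (u′ ×& v′ ⊆ t))) ⊢ D) →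
                C ⊗ z ∈ int& intX intY s ⊠ int& intX intY t ⊢ D
  int&-⊠-elim h =
    ⊗-assoc⁻ ⨾ int&-elim λ u′ v′ → ⊗-assoc ⨾ ⊗-mono ⊢-refl ⊗-comm ⨾ ⊗-assoc⁻
    ⨾ int&-elim λ u v → ⊗-assoc ⨾ ⊗-mono ⊢-refl ⊗-comm ⨾ h u u′ v v′

  ×⊗-I5 : ∀ {u u′ v v′} → I5 intX ⊗ I5 intY ⊢
          (intX u ×⊗ intY v) ⊠ (intX u′ ×⊗ intY v′) ⊆ intX (u ⊓ u′) ×⊗ intY (v ⊓ v′)
  ×⊗-I5 {u} {u′} {v} {v′} = ⊆-intro λ { (x , y) →
    ⊗-mono (⊗-mono (∀-elim u ⨾ ∀-elim u′) (∀-elim v ⨾ ∀-elim v′) ⨾ ×⊗-mono) ⊗-interchange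
    ⨾ ⊆-elim (x , y) }

  int&-I5 : I5 intX ⊗ I5 intY ⊢ I5 (int& intX intY)
  int&-I5 = ∀-intro λ s → ∀-intro λ t → ⊆-intro λ z → int&-⊠-elim λ u u′ v v′ →
    ⊗-mono ⊢-refl ⊗-interchange ⨾ ⊗-assoc⁻
    ⨾ ⊗-mono (⊗-mono ×⊗-I5 ⊢-refl ⨾ ⊆-elim z) ×&-⊓-⊆ ⨾ int&-intro (u ⊓ u′) (v ⊓ v′)

  int&-Cech : Cech intX ⊗ Cech intY ⊢ Cech (int& intX intY)
  int&-Cech =
    &-intro (⊗-mono &-fst &-fst ⨾ int&-I1)
    (&-intro (weaken ⨾ int&-I2)
    (&-intro (⊗-mono Cech⇒I4 Cech⇒I4 ⨾ int&-I4)
             (⊗-mono Cech⇒I5 Cech⇒I5 ⨾ int&-I5)))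
    where
    Cech⇒I4 : ∀ {Z : Set} {int : 𝒫 Z → 𝒫 Z} → Cech int ⊢ I4 int
    Cech⇒I4 = &-snd ⨾ &-snd ⨾ &-fst

    Cech⇒I5 : ∀ {Z : Set} {int : 𝒫 Z → 𝒫 Z} → Cech int ⊢ I5 int
    Cech⇒I5 = &-snd ⨾ &-snd ⨾ &-snd

proposition10 : (L : AffineLogic) {X Y : Set}
    (intX : (X → AffineLogic.Ω L) → (X → AffineLogic.Ω L))
    (intY : (Y → AffineLogic.Ω L) → (Y → AffineLogic.Ω L)) →
    let open Internal L in
    (I1 intX ⊗ I1 intY ⊢ I1 (int& intX intY))
    × (⊤ ⊢ I2 (int& intX intY))
    × (I4 intX ⊗ I4 intY ⊢ I4 (int& intX intY))
    × (I5 intX ⊗ I5 intY ⊢ I5 (int& intX intY))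
    × (Cech intX ⊗ Cech intY ⊢ Cech (int& intX intY))
proposition10 L intX intY = int&-I1 , int&-I2 , int&-I4 , int&-I5 , int&-Cech
  where open ProductInterior L intX intY
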